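{- Let \(\Delta = (\Sigma^{n}, \Sigma^{r} \subseteq \Sigma)\) be a signature and \(W\) a reachable \(\Sigma^{n}\)-model, i.e. the unique first-order homomorphism \(T_{\Sigma^{n}} \to W\) from the ground-term model is surjective. Then the hybrid-term model \((W, T^{W})\) is reachable: the unique \(\Delta\)-homomorphism \(h \colon (T_{\Sigma^{n}}, \{T^{\Delta}_{k}\}_{k \in T_{\Sigma^{n}}}) \to (W, \{T^{W}_{w}\}_{w \in |W|})\) is surjective (on possible worlds and, for each nominal term \(k\), on every carrier of the \(\Sigma\)-homomorphism \(h_k \colon T^{\Delta}_{k} \to T^{W}_{h(k)}\)).
   Context: First-order signatures \((S,F,P)\) are many-sorted; models and homomorphisms are the usual many-sorted ones. A signature is \(\Delta = (\Sigma^{n}, \Sigma^{r} \subseteq \Sigma)\) where \(\Sigma^{n} = (S^{n}, F^{n}, P^{n})\) is a first-order signature of nominals with a single sort \(\star\), and \(\Sigma^{r} = (S^{r}, F^{r}, P^{r}) \subseteq \Sigma = (S, F, P)\); symbols of \(\Sigma^{r}\) are rigid, \(F^{f}\), \(P^{f}\) denote the remaining (flexible) symbols. A \(\Delta\)-model is a pair \((W, M)\): \(W\) a \(\Sigma^{n}\)-model with world set \(|W|\) (carrier of \(\star\)), and \(M = \{M_w\}_{w \in |W|}\) \(\Sigma\)-models interpreting all rigid symbols identically. A \(\Delta\)-homomorphism \((W,M) \to (W',M')\) is a \(\Sigma^{n}\)-homomorphism \(h \colon W \to W'\) together with \(\Sigma\)-homomorphisms \(h_w \colon M_w \to M'_{h(w)}\)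 that coincide on rigid sorts for all \(w\). Hybrid terms over a \(\Sigma^{n}\)-model \(W\): \(T^{W} = \{T^{W}_{w}\}_{w \in |W|}\) is the least family of \(S\)-sorted sets with (1) \(\sigma(\tau) \in T^{W}_{w,s}\) for \(\sigma \in F^{r}_{ar\to s}\), \(\tau \in T^{W}_{w,ar}\); (2) \(\sigma(w,\tau) \in T^{W}_{w,s}\) for \(\sigma \in F^{f}_{ar\to s}\), \(\tau \in T^{W}_{w,ar}\); (3) \(T^{W}_{w_0,s} \subseteq T^{W}_{w,s}\) for all worlds \(w_0,w\) when \(s \in S^{r}\). Each \(T^{W}_w\) is a \(\Sigma\)-model (rigid \(\sigma\): \(\tau\mapsto\sigma(\tau)\); flexible \(\sigma\): \(\tau \mapsto \sigma(w,\tau)\); all relations empty), and \((W, T^{W})\) is a \(\Delta\)-model. For any \(\Delta\)-model \((W',M')\) and \(\Sigma^{n}\)-homomorphism \(f \colon W\to W'\) there is a unique \(\Delta\)-homomorphism \((W,T^{W}) \to (W',M')\) extending \(f\). Taking \(W = T_{\Sigma^{n}}\) (the first-order ground-term model of \(\Sigma^{n}\)) gives the standard hybrid-term model \((T_{\Sigma^{n}}, \{T^{\Delta}_{k}\}_{k \in T_{\Sigma^{n}}})\), which therefore has a unique \(\Delta\)-homomorphism into every \(\Delta\)-model. -}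

module Defs where

open import Data.List using (List; []; _∷_; length)
open import Data.List.Relation.Unary.All as All using (All; []; _∷_)
open import Data.Nat using (ℕ)
open import Data.Product using (Σ; ∃; _×_; _,_)
open import Data.Sum using (_⊎_; inj₁; inj₂)
open import Data.Unit using (⊤; tt)
open import Data.Empty using (⊥)
open import Relation.Binary.PropositionalEquality using (_≡_; refl; cong)

record Signature : Set₁ where
  field
    Sort : Set
    Op   : List Sort → Sort → Set
    Rel  : List Sort → Set
open Signature public

record Model (Sg : Signature) : Set₁ where
  field
    Car : Sort Sg → Set
    op  : ∀ {ar s} → Op Sg ar s → All Car ar → Car s
    rel : ∀ {ar} → Rel Sg ar → All Car ar → Set
open Model public

record Hom {Sg : Signature} (A B : Model Sg) : Set where
  field
    hmap : ∀ s → Car A s → Car B s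
    hop  : ∀ {ar s} (σ : Op Sg ar s) (xs : All (Car A) ar) →
           hmap s (op A σ xs) ≡ op B σ (All.map (λ {s'} → hmap s') xs)
    hrel : ∀ {ar} (π : Rel Sg ar) (xs : All (Car A) ar) →
           rel A π xs → rel B π (All.map (λ {s'} → hmap s') xs)
open Hom public

Surjective : ∀ {Sg} {A B : Model Sg} → Hom A B → Set
Surjective {Sg} {A} {B} h = ∀ s (y : Car B s) → ∃ λ x → hmap h s x ≡ y

data GTerm (Sg : Signature) : Sort Sg → Set where
  app : ∀ {ar s} → Op Sg ar s → All (GTerm Sg) ar → GTerm Sg s

groundModel : (Sg : Signature) → Model Sg
groundModel Sg = record { Car = GTerm Sg ; op = app ; rel = λ _ _ → ⊥ }

module _ {Sg : Signature} (M : Model Sg) where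
  mutual
    eval : ∀ {s} → GTerm Sg s → Car M s
    eval (app σ ts) = op M σ (evalAll ts)

    evalAll : ∀ {ar} → All (GTerm Sg) ar → All (Car M) ar
    evalAll [] = []
    evalAll (t ∷ ts) = eval t ∷ evalAll ts

  evalAll-map : ∀ {ar} (ts : All (GTerm Sg) ar) → evalAll ts ≡ All.map eval ts
  evalAll-map [] = refl
  evalAll-map (t ∷ ts) = cong (eval t ∷_) (evalAll-map ts)

  initialHom : Hom (groundModel Sg) M
  initialHom = record
    { hmap = λ s → eval
    ; hop  = λ σ ts → cong (op M σ) (evalAll-map ts)
    ; hrel = λ π xs () }

Reachable : ∀ {Sg} → Model Sg → Set
Reachable M = Surjective (initialHom M)

-- Hybrid signatures Δ = (Σⁿ, Σʳ ⊆ Σ)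
-- Sorts of Σ are  S = Sr ⊎ Sf  (rigid sorts ⊎ flexible sorts);
-- function symbols F = Fʳ ⊎ Fᶠ, relation symbols P = Pʳ ⊎ Pᶠ,
-- where Σʳ = (Sr, Fr, Pr) only mentions rigid sorts.

record DSig : Set₁ where
  field
    NOp  : ℕ → Set                 -- nominal function symbols by arity (single sort ⋆)
    NRel : ℕ → Set
    Sr   : Set
    Sf   : Set
    Fr   : List Sr → Sr → Set
    Ff   : List (Sr ⊎ Sf) → Sr ⊎ Sf → Set
    Pr   : List Sr → Set
    Pf   : List (Sr ⊎ Sf) → Set
open DSig public

NomSig : DSig → Signature
NomSig Δ = record { Sort = ⊤ ; Op = λ ar _ → NOp Δ (length ar) ; Rel = λ ar → NRel Δ (length ar) }

CarOf : ∀ {Sr Sf : Set} → (Sr → Set) → (Sf → Set) → Sr ⊎ Sf → Set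
CarOf R F (inj₁ r) = R r
CarOf R F (inj₂ f) = F f

-- Δ-model (W, M): rigid sorts/symbols are interpreted once (hence identically
-- in all worlds), flexible ones per world.  M_w has carrier  CarOf CarR (CarF w).
record DModel (Δ : DSig) : Set₁ where
  field
    W    : Model (NomSig Δ)
    CarR : Sr Δ → Set
    CarF : Car W tt → Sf Δ → Set
    opR  : ∀ {ar s} → Fr Δ ar s → All CarR ar → CarR s
    opF  : ∀ (w : Car W tt) {ar s} → Ff Δ ar s →
           All (CarOf CarR (CarF w)) ar → CarOf CarR (CarF w) s
    relR : ∀ {ar} → Pr Δ ar → All CarR ar → Set
    relF : ∀ (w : Car W tt) {ar} → Pf Δ ar → All (CarOf CarR (CarF w)) ar → Set
open DModel public

Worlds : ∀ {Δ} → DModel Δ → Set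
Worlds M = Car (W M) tt

CarAt : ∀ {Δ} (M : DModel Δ) → Worlds M → Sr Δ ⊎ Sf Δ → Set
CarAt M w = CarOf (CarR M) (CarF M w)

record DHom {Δ : DSig} (A B : DModel Δ) : Set where
  field
    hN : Hom (W A) (W B)
    hs : ∀ (w : Worlds A) s → CarAt A w s → CarAt B (hmap hN tt w) s
    rigidAgree : ∀ (w w' : Worlds A) r (x : CarR A r) → hs w (inj₁ r) x ≡ hs w' (inj₁ r) x
    presR : ∀ (w : Worlds A) {ar s} (σ : Fr Δ ar s) (xs : All (CarR A) ar) →
            hs w (inj₁ s) (opR A σ xs) ≡ opR B σ (All.map (λ {r} → hs w (inj₁ r)) xs)
    presF : ∀ (w : Worlds A) {ar s} (σ : Ff Δ ar s) (xs : All (CarAt A w) ar) →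
            hs w s (opF A w σ xs) ≡ opF B (hmap hN tt w) σ (All.map (λ {s'} → hs w s') xs)
    presRelR : ∀ (w : Worlds A) {ar} (π : Pr Δ ar) (xs : All (CarR A) ar) →
               relR A π xs → relR B π (All.map (λ {r} → hs w (inj₁ r)) xs)
    presRelF : ∀ (w : Worlds A) {ar} (π : Pf Δ ar) (xs : All (CarAt A w) ar) →
               relF A w π xs → relF B (hmap hN tt w) π (All.map (λ {s'} → hs w s') xs)
open DHom public

DSurjective : ∀ {Δ} {A B : DModel Δ} → DHom A B → Set
DSurjective {A = A} {B} h =
  Surjective (hN h) ×
  (∀ (k : Worlds A) s (y : CarAt B (hmap (hN h) tt k) s) → ∃ λ x → hs h k s x ≡ y)

-- Hybrid terms over a Σⁿ-model W.
-- Rigid-sort terms are world independent (index tt); flexible-sort terms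
-- are indexed by a world.  T^W_{w,s} = HT s (loc w s).

module _ (Δ : DSig) (World : Set) where
  Idx : Sr Δ ⊎ Sf Δ → Set
  Idx (inj₁ _) = ⊤
  Idx (inj₂ _) = World

  loc : World → (s : Sr Δ ⊎ Sf Δ) → Idx s
  loc w (inj₁ _) = tt
  loc w (inj₂ _) = w

  data HT : (s : Sr Δ ⊎ Sf Δ) → Idx s → Set where
    rig : ∀ {ar s} → Fr Δ ar s → All (λ r → HT (inj₁ r) tt) ar → HT (inj₁ s) tt
    flx : ∀ {ar s} (w : World) → Ff Δ ar s → All (λ s' → HT s' (loc w s')) ar → HT s (loc w s)

  HTR : Sr Δ → Set
  HTR r = HT (inj₁ r) tt

  HTF : World → Sf Δ → Set
  HTF w f = HT (inj₂ f) w

  toC : ∀ w s → HT s (loc w s) → CarOf HTR (HTF w) s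
  toC w (inj₁ _) t = t
  toC w (inj₂ _) t = t

  fromC : ∀ w s → CarOf HTR (HTF w) s → HT s (loc w s)
  fromC w (inj₁ _) t = t
  fromC w (inj₂ _) t = t

hybridTermModel : (Δ : DSig) → Model (NomSig Δ) → DModel Δ
hybridTermModel Δ Wm = record
  { W    = Wm
  ; CarR = HTR Δ (Car Wm tt)
  ; CarF = HTF Δ (Car Wm tt)
  ; opR  = rig
  ; opF  = λ w {ar} {s} σ xs → toC Δ (Car Wm tt) w s (flx w σ (All.map (λ {s'} → fromC Δ (Car Wm tt) w s') xs))
  ; relR = λ _ _ → ⊥
  ; relF = λ _ _ _ → ⊥ }

standardHybridTermModel : (Δ : DSig) → DModel Δ
standardHybridTermModel Δ = hybridTermModel Δ (groundModel (NomSig Δ))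

module Submission where

-- A Σⁿ-homomorphism out of the ground-term model is forced to be evaluation, so on worlds
-- surjectivity is reachability of W.  A
-- term σ(w, τ) of flexible sort lives at the world w = h(k) it is asked about and is the
-- image of σ(k, τ'), with τ' preimages of the arguments τ.  A term σ(w, τ) of rigid sort
-- may mention an arbitrary world w: reachability supplies a nominal k' with h(k') = w,
-- σ(k', τ') is a preimage under h_k', and since h_k and h_k' agree on rigid sorts it is
-- also a preimage under h_k.

open import Defs
open import Data.List as List using ()
open import Data.List.Relation.Unary.All as All using (All; []; _∷_)
open import Data.Product using (∃; _,_)
open import Data.Sum using (inj₁; inj₂)
open import Data.Unit using (tt)
open import Relation.Binary.PropositionalEquality using (_≡_; refl; trans; cong; cong₂)

module _ {Sg : Signature} (M : Model Sg) (g : Hom (groundModel Sg) M) where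

  mutual
    initialHom-unique : ∀ {s} (t : GTerm Sg s) → hmap g s t ≡ eval M t
    initialHom-unique (app σ ts) = trans (hop g σ ts) (cong (op M σ) (initialHom-uniqueAll ts))

    initialHom-uniqueAll : ∀ {ar} (ts : All (GTerm Sg) ar) →
                           All.map (λ {s} → hmap g s) ts ≡ evalAll M ts
    initialHom-uniqueAll []       = refl
    initialHom-uniqueAll (t ∷ ts) = cong₂ _∷_ (initialHom-unique t) (initialHom-uniqueAll ts)

  reachable⇒surjective : Reachable M → Surjective g
  reachable⇒surjective reach s y with reach s y
  ... | t , eval-t≡y = t , trans (initialHom-unique t) eval-t≡y

module _ (Δ : DSig) {W : Model (NomSig Δ)} (reach : Reachable W)
         (h : DHom (standardHybridTermModel Δ) (hybridTermModel Δ W)) where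

  private
    T = standardHybridTermModel Δ
    Ω = Car W tt

    h⋆ : Worlds T → Ω
    h⋆ = hmap (hN h) tt

  mutual
    hybridHom-preimage : ∀ k s (y : CarAt (hybridTermModel Δ W) (h⋆ k) s) →
                         ∃ λ x → hs h k s x ≡ y
    hybridHom-preimage k (inj₁ _) (rig σ ys) with rigid-preimages k ys
    ... | xs , xs↦ys = rig σ xs , trans (presR h k σ xs) (cong (rig σ) xs↦ys)
    hybridHom-preimage k (inj₁ r) (flx w σ ys)
      with reachable⇒surjective W (hN h) reach tt w
    ... | k′ , refl with preimages k′ ys
    ... | xs , xs↦ys = opF T k′ σ xs
                     , trans (rigidAgree h k k′ r (opF T k′ σ xs))
                             (trans (presF h k′ σ xs) (cong (flx (h⋆ k′) σ) xs↦ys))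
    hybridHom-preimage k (inj₂ _) (flx _ σ ys) with preimages k ys
    ... | xs , xs↦ys = opF T k σ xs , trans (presF h k σ xs) (cong (flx (h⋆ k) σ) xs↦ys)

    rigid-preimages : ∀ k {ar} (ys : All (HTR Δ Ω) ar) →
                      ∃ λ xs → All.map (λ {r} → hs h k (inj₁ r)) xs ≡ ys
    rigid-preimages k []       = [] , refl
    rigid-preimages k (y ∷ ys) with hybridHom-preimage k (inj₁ _) y | rigid-preimages k ys
    ... | x , x↦y | xs , xs↦ys = x ∷ xs , cong₂ _∷_ x↦y xs↦ys

    preimages : ∀ k {ar} (ys : All (λ s → HT Δ Ω s (loc Δ Ω (h⋆ k) s)) ar) →
                ∃ λ xs → All.map (λ {s} → fromC Δ Ω (h⋆ k) s)
                                 (All.map (λ {s} → hs h k s) xs) ≡ ys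
    preimages k [] = [] , refl
    preimages k {inj₁ r List.∷ _} (y ∷ ys) with hybridHom-preimage k (inj₁ r) y | preimages k ys
    ... | x , x↦y | xs , xs↦ys = x ∷ xs , cong₂ _∷_ x↦y xs↦ys
    preimages k {inj₂ f List.∷ _} (y ∷ ys) with hybridHom-preimage k (inj₂ f) y | preimages k ys
    ... | x , x↦y | xs , xs↦ys = x ∷ xs , cong₂ _∷_ x↦y xs↦ys

proposition2 : (Δ : DSig) (W : Model (NomSig Δ)) → Reachable W →
    (h : DHom (standardHybridTermModel Δ) (hybridTermModel Δ W)) → DSurjective h
proposition2 Δ W reach h =
  reachable⇒surjective W (hN h) reach , hybridHom-preimage Δ reach h
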